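{- Let $G$ be a connected graph and let $e=uv$ be an edge of $G$. Let $S(G)_e$ be the set of simplicial vertices of $G$ that are adjacent to both $u$ and $v$. Then $$\mathrm{gp}_{\rm t}(G)-|S(G)_e|\le \mathrm{gp}_{\rm t}(G-e)\le \mathrm{gp}_{\rm t}(G)+2.$$ Moreover, both bounds are sharp, i.e., each holds with equality for some graph $G$ and edge $e$.
   Context: All graphs are finite, simple and connected. For a graph $G$ and $Z\subseteq V(G)$, two vertices $p,q\in V(G)$ are $Z$-positionable if no shortest $p,q$-path in $G$ has an internal vertex in $Z$. $Z$ is a total general position set if every two vertices of $V(G)$ are $Z$-positionable, and $\mathrm{gp}_{\rm t}(G)$ is the maximum cardinality of a total general position set of $G$. A vertex is simplicial if its neighbourhood induces a complete graph. $G-e$ is the graph obtained by deleting the edge $e$. -}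

module Defs where

open import Data.Nat using (ℕ; zero; suc; _≤_)
open import Data.Fin using (Fin; _≟_)
open import Data.Fin.Subset using (Subset; _∈_; _∉_; ∣_∣)
open import Data.Bool using (Bool; true; false; _∧_; _∨_; not)
open import Data.List using (List; []; _∷_)
open import Data.List.Relation.Unary.All using (All)
open import Data.Product using (Σ; _×_; ∃)
open import Relation.Nullary.Decidable using (⌊_⌋)
open import Relation.Binary.PropositionalEquality using (_≡_; _≢_)

Adj : ℕ → Set
Adj n = Fin n → Fin n → Bool

IsSimple : ∀ {n} → Adj n → Set
IsSimple {n} A = (∀ (x y : Fin n) → A x y ≡ A y x) × (∀ (x : Fin n) → A x x ≡ false)

data Walk {n : ℕ} (A : Adj n) : Fin n → Fin n → ℕ → Set where
  nil  : (x : Fin n) → Walk A x x zero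
  step : ∀ {x y z k} → A x y ≡ true → Walk A y z k → Walk A x z (suc k)

inner : ∀ {n} {A : Adj n} {x z k} → Walk A x z k → List (Fin n)
inner (nil x) = []
inner (step h (nil y)) = []
inner (step {y = y} h (step h' w)) = y ∷ inner (step h' w)

Connected : ∀ {n} → Adj n → Set
Connected {n} A = ∀ (p q : Fin n) → ∃ λ k → Walk A p q k

-- A shortest p,q-path: a p,q-walk of minimum length (such walks are paths).
IsShortest : ∀ {n} {A : Adj n} {p q k} → Walk A p q k → Set
IsShortest {n} {A} {p} {q} {k} w = ∀ k' → Walk A p q k' → k ≤ k'

Positionable : ∀ {n} → Adj n → Subset n → Fin n → Fin n → Set
Positionable A Z p q = ∀ k (w : Walk A p q k) → IsShortest w → All (λ x → x ∉ Z) (inner w)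

IsTotalGP : ∀ {n} → Adj n → Subset n → Set
IsTotalGP {n} A Z = ∀ (p q : Fin n) → Positionable A Z p q

IsGpt : ∀ {n} → Adj n → ℕ → Set
IsGpt {n} A m =
  (Σ (Subset n) λ Z → IsTotalGP A Z × ∣ Z ∣ ≡ m) ×
  (∀ (Z : Subset n) → IsTotalGP A Z → ∣ Z ∣ ≤ m)

IsSimplicial : ∀ {n} → Adj n → Fin n → Set
IsSimplicial {n} A w =
  ∀ (x y : Fin n) → A w x ≡ true → A w y ≡ true → x ≢ y → A x y ≡ true

deleteEdge : ∀ {n} → Adj n → Fin n → Fin n → Adj n
deleteEdge A u v x y =
  A x y ∧ not ((⌊ x ≟ u ⌋ ∧ ⌊ y ≟ v ⌋) ∨ (⌊ x ≟ v ⌋ ∧ ⌊ y ≟ u ⌋))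

-- Standing hypotheses: G simple and connected, uv an edge, G - uv connected
-- (all graphs are connected by convention, so gp_t(G - e) is only meaningful then).
Setting : ∀ {n} → Adj n → Fin n → Fin n → Set
Setting A u v =
  IsSimple A × Connected A × A u v ≡ true × Connected (deleteEdge A u v)

IsSe : ∀ {n} → Adj n → Fin n → Fin n → Subset n → Set
IsSe {n} A u v S =
  ∀ (w : Fin n) → (w ∈ S → IsSimplicial A w × A w u ≡ true × A w v ≡ true) ×
                  (IsSimplicial A w × A w u ≡ true × A w v ≡ true → w ∈ S)

-- A set is in total general position exactly when all its vertices are simplicial: a
-- simplicial internal vertex y of a walk x–y–z can be bypassed (x = z or xz is an edge), and
-- a non-simplicial z with non-adjacent neighbours x, y is internal to the shortest path x–z–y.
-- Hence gp_t(G) is the number of simplicial vertices.  Deleting uv keeps a simplicial vertex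
-- simplicial unless it is adjacent to both u and v, and only u and v can become simplicial.
-- Sharpness: K₃ − e has 2 = 3 − 1 simplicial vertices, C₄ − e has 2 = 0 + 2.
module Submission where

open import Defs
open import Data.Bool using (true; false; not; _∧_; _∨_)
import Data.Bool.Properties as Bool
open import Data.Fin using (Fin; zero; suc; toℕ; _≟_; #_)
open import Data.Fin.Properties using (all?)
open import Data.Fin.Subset using (Subset; _∈_; _⊆_; _∪_; ⁅_⁆; ∣_∣; inside; outside)
open import Data.Fin.Subset.Properties using (p⊆q⇒∣p∣≤∣q∣; x∈p∪q⁺; x∈⁅x⁆; ∣⁅x⁆∣≡1)
open import Data.List.Relation.Unary.All using () renaming (head to All-head)
open import Data.List.Relation.Unary.All.Properties using (¬Any⇒All¬)
open import Data.List.Relation.Unary.Any as Any using (Any; here; there)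
open import Data.Nat using (ℕ; zero; suc; _+_; _≤_; _<_; z≤n; s≤s; NonZero; _%_)
import Data.Nat as ℕ
open import Data.Nat.Properties
  using (≤-refl; ≤-reflexive; ≤-trans; ≤-antisym; <⇒≱; m≤n⇒m≤1+n; +-suc; +-monoʳ-≤; module ≤-Reasoning)
open import Data.Product using (Σ; _×_; _,_; -,_; proj₁; proj₂; ∃)
open import Data.Sum using (inj₁; inj₂)
open import Data.Vec using ([]; _∷_; tabulate)
open import Data.Vec.Properties using (lookup∘tabulate; []=⇒lookup; lookup⇒[]=)
open import Function using (_∘_)
open import Function.Bundles using (_⇔_; mk⇔; Equivalence)
open import Relation.Nullary using (¬_; Dec; yes; no; ¬?; contradiction)
open import Relation.Nullary.Decidable using (⌊_⌋; _×-dec_; _→-dec_; toWitness; fromWitness; from-yes)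
open import Relation.Unary using (Pred; Decidable)
open import Level using (0ℓ)
open import Relation.Binary.PropositionalEquality
  using (_≡_; _≢_; refl; sym; trans; cong; cong₂)

open Equivalence using (to; from)

private
  variable
    n k l : ℕ

IsSymmetric : Adj n → Set
IsSymmetric {n} A = ∀ (x y : Fin n) → A x y ≡ A y x

decSubset : {P : Pred (Fin n) 0ℓ} → Decidable P → Subset n
decSubset P? = tabulate (λ x → ⌊ P? x ⌋)

∈-decSubset : {P : Pred (Fin n) 0ℓ} (P? : Decidable P) {x : Fin n} → x ∈ decSubset P? ⇔ P x
∈-decSubset P? {x} = mk⇔
  (λ x∈ → toWitness {a? = P? x} (Bool.T-≡ .from (trans (sym (lookup∘tabulate _ x)) ([]=⇒lookup x∈))))
  (λ Px → lookup⇒[]= x _ (trans (lookup∘tabulate _ x) (Bool.T-≡ .to (fromWitness {a? = P? x} Px))))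

∣p∪q∣≤∣p∣+∣q∣ : (p q : Subset n) → ∣ p ∪ q ∣ ≤ ∣ p ∣ + ∣ q ∣
∣p∪q∣≤∣p∣+∣q∣ [] [] = z≤n
∣p∪q∣≤∣p∣+∣q∣ (outside ∷ p) (outside ∷ q) = ∣p∪q∣≤∣p∣+∣q∣ p q
∣p∪q∣≤∣p∣+∣q∣ (inside  ∷ p) (outside ∷ q) = s≤s (∣p∪q∣≤∣p∣+∣q∣ p q)
∣p∪q∣≤∣p∣+∣q∣ (outside ∷ p) (inside  ∷ q) =
  ≤-trans (s≤s (∣p∪q∣≤∣p∣+∣q∣ p q)) (≤-reflexive (sym (+-suc ∣ p ∣ ∣ q ∣)))
∣p∪q∣≤∣p∣+∣q∣ (inside  ∷ p) (inside  ∷ q) =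
  s≤s (≤-trans (m≤n⇒m≤1+n (∣p∪q∣≤∣p∣+∣q∣ p q)) (≤-reflexive (sym (+-suc ∣ p ∣ ∣ q ∣))))

module _ {A : Adj n} where

  _++ʷ_ : ∀ {x y z} → Walk A x y k → Walk A y z l → Walk A x z (k + l)
  nil _    ++ʷ w′ = w′
  step h w ++ʷ w′ = step h (w ++ʷ w′)

  snocʷ : ∀ {x y z} → Walk A x y k → A y z ≡ true → Walk A x z (suc k)
  snocʷ (nil _)    h′ = step h′ (nil _)
  snocʷ (step h w) h′ = step h (snocʷ w h′)

  reverseʷ : IsSymmetric A → ∀ {x y} → Walk A x y k → Walk A y x k
  reverseʷ A-sym (nil x)                = nil x
  reverseʷ A-sym (step {x = x} {y} h w) = snocʷ (reverseʷ A-sym w) (trans (A-sym y x) h)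

  connected-viaHub : IsSymmetric A → (c : Fin n) → (∀ x → ∃ λ k → Walk A x c k) → Connected A
  connected-viaHub A-sym c toHub p q = -, proj₂ (toHub p) ++ʷ reverseʷ A-sym (proj₂ (toHub q))

  shortcut : IsSymmetric A → ∀ {p q} (w : Walk A p q k) →
             Any (IsSimplicial A) (inner w) → ∃ λ k′ → k′ < k × Walk A p q k′
  shortcut A-sym (step {x = p} {y} h (step {y = z} {k = k} h′ w)) (here simplicial) with p ≟ z
  ... | yes refl = k , m≤n⇒m≤1+n ≤-refl , w
  ... | no p≢z   = suc k , ≤-refl , step (simplicial p z (trans (A-sym y p) h) h′ p≢z) w
  shortcut A-sym (step h (step h′ w)) (there inner-simplicial)
    with k′ , k′<k , w′ ← shortcut A-sym (step h′ w) inner-simplicial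
    = suc k′ , s≤s k′<k , step h w′

  simplicial⇒totalGP : IsSymmetric A → {Z : Subset n} →
                       (∀ z → z ∈ Z → IsSimplicial A z) → IsTotalGP A Z
  simplicial⇒totalGP A-sym simplicial p q k w shortest = ¬Any⇒All¬ (inner w) λ inner∩Z →
    let k′ , k′<k , w′ = shortcut A-sym w (Any.map (simplicial _) inner∩Z)
    in <⇒≱ k′<k (shortest k′ w′)

  totalGP⇒simplicial : IsSymmetric A → {Z : Subset n} →
                       IsTotalGP A Z → ∀ z → z ∈ Z → IsSimplicial A z
  totalGP⇒simplicial A-sym totalGP z z∈Z x y zx zy x≢y with A x y in xy
  ... | true  = refl
  ... | false = contradiction z∈Z (All-head (totalGP x y 2 x–z–y shortest))
    where
    x–z–y : Walk A x y 2
    x–z–y = step (trans (A-sym x z) zx) (step zy (nil y))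

    shortest : IsShortest x–z–y
    shortest zero (nil _) = contradiction refl x≢y
    shortest (suc zero) (step h (nil _)) with () ← trans (sym xy) h
    shortest (suc (suc _)) _ = s≤s (s≤s z≤n)

simplicial? : (A : Adj n) → Decidable (IsSimplicial A)
simplicial? A w = all? λ x → all? λ y →
  A w x Bool.≟ true →-dec A w y Bool.≟ true →-dec ¬? (x ≟ y) →-dec A x y Bool.≟ true

simplicials : Adj n → Subset n
simplicials A = decSubset (simplicial? A)

∈-simplicials : {A : Adj n} {w : Fin n} → w ∈ simplicials A ⇔ IsSimplicial A w
∈-simplicials {A = A} = ∈-decSubset (simplicial? A)

module _ {A : Adj n} (A-sym : IsSymmetric A) where

  simplicials-totalGP : IsTotalGP A (simplicials A)
  simplicials-totalGP = simplicial⇒totalGP A-sym λ _ → ∈-simplicials .to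

  totalGP⇒⊆simplicials : {Z : Subset n} → IsTotalGP A Z → Z ⊆ simplicials A
  totalGP⇒⊆simplicials totalGP z∈Z = ∈-simplicials .from (totalGP⇒simplicial A-sym totalGP _ z∈Z)

  isGpt-simplicials : IsGpt A ∣ simplicials A ∣
  isGpt-simplicials =
    (simplicials A , simplicials-totalGP , refl) , λ _ → p⊆q⇒∣p∣≤∣q∣ ∘ totalGP⇒⊆simplicials

  isGpt⇒≡∣simplicials∣ : ∀ {m} → IsGpt A m → m ≡ ∣ simplicials A ∣
  isGpt⇒≡∣simplicials∣ ((_ , totalGP , refl) , maximal) =
    ≤-antisym (p⊆q⇒∣p∣≤∣q∣ (totalGP⇒⊆simplicials totalGP)) (maximal _ simplicials-totalGP)

⌊⌋∧⌊⌋≡false : {P Q : Set} (P? : Dec P) (Q? : Dec Q) → ¬ (P × Q) → ⌊ P? ⌋ ∧ ⌊ Q? ⌋ ≡ false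
⌊⌋∧⌊⌋≡false (yes p) (yes q) ¬pq = contradiction (p , q) ¬pq
⌊⌋∧⌊⌋≡false (yes _) (no _)  _   = refl
⌊⌋∧⌊⌋≡false (no _)  _       _   = refl

module _ {A : Adj n} {u v : Fin n} where

  deleteEdge-sym : IsSymmetric A → IsSymmetric (deleteEdge A u v)
  deleteEdge-sym A-sym x y =
    cong₂ _∧_ (A-sym x y) (cong not (swap ⌊ x ≟ u ⌋ ⌊ y ≟ v ⌋ ⌊ x ≟ v ⌋ ⌊ y ≟ u ⌋))
    where
    swap : ∀ a b c d → (a ∧ b) ∨ (c ∧ d) ≡ (d ∧ c) ∨ (b ∧ a)
    swap a b c d = trans (Bool.∨-comm (a ∧ b) (c ∧ d)) (cong₂ _∨_ (Bool.∧-comm c d) (Bool.∧-comm a b))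

  deleteEdge⊆ : ∀ {x y} → deleteEdge A u v x y ≡ true → A x y ≡ true
  deleteEdge⊆ {x} {y} _ with A x y
  deleteEdge⊆ _  | true  = refl
  deleteEdge⊆ () | false

  connected-deleteEdge⁻ : Connected (deleteEdge A u v) → Connected A
  connected-deleteEdge⁻ connected p q = -, liftʷ (proj₂ (connected p q))
    where
    liftʷ : ∀ {x y} → Walk (deleteEdge A u v) x y k → Walk A x y k
    liftʷ (nil x)    = nil x
    liftʷ (step h w) = step (deleteEdge⊆ h) (liftʷ w)

  deleteEdge-other : ∀ {x y} → ¬ (x ≡ u × y ≡ v) → ¬ (x ≡ v × y ≡ u) → deleteEdge A u v x y ≡ A x y
  deleteEdge-other {x} {y} ¬uv ¬vu
    rewrite ⌊⌋∧⌊⌋≡false (x ≟ u) (y ≟ v) ¬uv | ⌊⌋∧⌊⌋≡false (x ≟ v) (y ≟ u) ¬vu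
    = Bool.∧-identityʳ (A x y)

  simplicial-deleteEdge⁺ : ∀ {w} → IsSimplicial A w → ¬ (A w u ≡ true × A w v ≡ true) →
                           IsSimplicial (deleteEdge A u v) w
  simplicial-deleteEdge⁺ simplicial ¬uv x y wx wy x≢y =
    trans (deleteEdge-other (λ { (refl , refl) → ¬uv (wx′ , wy′) }) (λ { (refl , refl) → ¬uv (wy′ , wx′) }))
          (simplicial x y wx′ wy′ x≢y)
    where
    wx′ = deleteEdge⊆ wx
    wy′ = deleteEdge⊆ wy

  simplicial-deleteEdge⁻ : ∀ {w} → w ≢ u → w ≢ v → IsSimplicial (deleteEdge A u v) w → IsSimplicial A w
  simplicial-deleteEdge⁻ {w} w≢u w≢v simplicial x y wx wy x≢y =
    deleteEdge⊆ (simplicial x y (trans unchanged wx) (trans unchanged wy) x≢y)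
    where
    unchanged : ∀ {x} → deleteEdge A u v w x ≡ A w x
    unchanged = deleteEdge-other (w≢u ∘ proj₁) (w≢v ∘ proj₁)

  simplicials⊆simplicials-deleteEdge∪Se : ∀ {S} → IsSe A u v S →
                                           simplicials A ⊆ simplicials (deleteEdge A u v) ∪ S
  simplicials⊆simplicials-deleteEdge∪Se Se {w} w∈
    with ∈-simplicials .to w∈ | A w u Bool.≟ true ×-dec A w v Bool.≟ true
  ... | simplicial | yes (wu , wv) = x∈p∪q⁺ (inj₂ (proj₂ (Se w) (simplicial , wu , wv)))
  ... | simplicial | no ¬uv        =
    x∈p∪q⁺ (inj₁ (∈-simplicials .from (simplicial-deleteEdge⁺ simplicial ¬uv)))

  simplicials-deleteEdge⊆simplicials∪⁅u⁆∪⁅v⁆ :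
    simplicials (deleteEdge A u v) ⊆ simplicials A ∪ (⁅ u ⁆ ∪ ⁅ v ⁆)
  simplicials-deleteEdge⊆simplicials∪⁅u⁆∪⁅v⁆ {w} w∈ with w ≟ u | w ≟ v
  ... | yes refl | _        = x∈p∪q⁺ (inj₂ (x∈p∪q⁺ (inj₁ (x∈⁅x⁆ w))))
  ... | no _     | yes refl = x∈p∪q⁺ (inj₂ (x∈p∪q⁺ (inj₂ (x∈⁅x⁆ w))))
  ... | no w≢u   | no w≢v   =
    x∈p∪q⁺ (inj₁ (∈-simplicials .from (simplicial-deleteEdge⁻ w≢u w≢v (∈-simplicials .to w∈))))

  ∣simplicials∣≤∣simplicials-deleteEdge∣+∣Se∣ : ∀ {S} → IsSe A u v S →
    ∣ simplicials A ∣ ≤ ∣ simplicials (deleteEdge A u v) ∣ + ∣ S ∣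
  ∣simplicials∣≤∣simplicials-deleteEdge∣+∣Se∣ {S} Se =
    ≤-trans (p⊆q⇒∣p∣≤∣q∣ (simplicials⊆simplicials-deleteEdge∪Se Se))
            (∣p∪q∣≤∣p∣+∣q∣ (simplicials (deleteEdge A u v)) S)

  ∣simplicials-deleteEdge∣≤∣simplicials∣+2 : ∣ simplicials (deleteEdge A u v) ∣ ≤ ∣ simplicials A ∣ + 2
  ∣simplicials-deleteEdge∣≤∣simplicials∣+2 = begin
    ∣ simplicials (deleteEdge A u v) ∣       ≤⟨ p⊆q⇒∣p∣≤∣q∣ simplicials-deleteEdge⊆simplicials∪⁅u⁆∪⁅v⁆ ⟩
    ∣ simplicials A ∪ (⁅ u ⁆ ∪ ⁅ v ⁆) ∣     ≤⟨ ∣p∪q∣≤∣p∣+∣q∣ (simplicials A) _ ⟩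
    ∣ simplicials A ∣ + ∣ ⁅ u ⁆ ∪ ⁅ v ⁆ ∣   ≤⟨ +-monoʳ-≤ ∣ simplicials A ∣ (∣p∪q∣≤∣p∣+∣q∣ ⁅ u ⁆ ⁅ v ⁆) ⟩
    ∣ simplicials A ∣ + (∣ ⁅ u ⁆ ∣ + ∣ ⁅ v ⁆ ∣) ≡⟨ cong (∣ simplicials A ∣ +_) (cong₂ _+_ (∣⁅x⁆∣≡1 u) (∣⁅x⁆∣≡1 v)) ⟩
    ∣ simplicials A ∣ + 2                   ∎
    where open ≤-Reasoning

  gpt-deleteEdge-bounds : IsSymmetric A → ∀ {S m m′} → IsSe A u v S →
                          IsGpt A m → IsGpt (deleteEdge A u v) m′ → m ≤ m′ + ∣ S ∣ × m′ ≤ m + 2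
  gpt-deleteEdge-bounds A-sym Se gpt gpt′
    rewrite isGpt⇒≡∣simplicials∣ A-sym gpt | isGpt⇒≡∣simplicials∣ (deleteEdge-sym A-sym) gpt′
    = ∣simplicials∣≤∣simplicials-deleteEdge∣+∣Se∣ Se , ∣simplicials-deleteEdge∣≤∣simplicials∣+2

mkSetting : {A : Adj n} {u v : Fin n} → IsSimple A → A u v ≡ true → Connected (deleteEdge A u v) →
            Setting A u v
mkSetting simple uv connected = simple , connected-deleteEdge⁻ connected , uv , connected

simple? : (A : Adj n) → Dec (IsSimple A)
simple? A = (all? λ x → all? λ y → A x y Bool.≟ A y x) ×-dec all? λ x → A x x Bool.≟ false

commonSimplicialNeighbours : Adj n → Fin n → Fin n → Subset n
commonSimplicialNeighbours A u v =
  decSubset λ w → simplicial? A w ×-dec A w u Bool.≟ true ×-dec A w v Bool.≟ true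

isSe-commonSimplicialNeighbours : (A : Adj n) (u v : Fin n) → IsSe A u v (commonSimplicialNeighbours A u v)
isSe-commonSimplicialNeighbours A u v w = ∈-decSubset _ .to , ∈-decSubset _ .from

complete : (n : ℕ) → Adj n
complete n x y = not ⌊ x ≟ y ⌋

cycle : (n : ℕ) → .{{NonZero n}} → Adj n
cycle n x y = ⌊ toℕ y ℕ.≟ suc (toℕ x) % n ⌋ ∨ ⌊ toℕ x ℕ.≟ suc (toℕ y) % n ⌋

K₃ : Adj 3
K₃ = complete 3

C₄ : Adj 4
C₄ = cycle 4

K₃-simple : IsSimple K₃
K₃-simple = from-yes (simple? K₃)

C₄-simple : IsSimple C₄
C₄-simple = from-yes (simple? C₄)

K₃∖e-connected : Connected (deleteEdge K₃ (# 0) (# 1))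
K₃∖e-connected = connected-viaHub (deleteEdge-sym (proj₁ K₃-simple)) (# 2) λ where
  zero                → -, step refl (nil _)
  (suc zero)          → -, step refl (nil _)
  (suc (suc zero))    → -, nil _

C₄∖e-connected : Connected (deleteEdge C₄ (# 0) (# 1))
C₄∖e-connected = connected-viaHub (deleteEdge-sym (proj₁ C₄-simple)) (# 3) λ where
  zero                   → -, step refl (nil _)
  (suc zero)             → -, step {y = # 2} refl (step refl (nil _))
  (suc (suc zero))       → -, step refl (nil _)
  (suc (suc (suc zero))) → -, nil _

proposition4p1 :
    ((n : ℕ) (A : Adj n) (u v : Fin n) → Setting A u v →
      (S : Subset n) → IsSe A u v S →
      (m m' : ℕ) → IsGpt A m → IsGpt (deleteEdge A u v) m' →
      (m ≤ m' + ∣ S ∣) × (m' ≤ m + 2))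
    ×
    (Σ ℕ λ n → Σ (Adj n) λ A → Σ (Fin n) λ u → Σ (Fin n) λ v →
      Σ (Subset n) λ S → Σ ℕ λ m → Σ ℕ λ m' →
      Setting A u v × IsSe A u v S × IsGpt A m × IsGpt (deleteEdge A u v) m' ×
      m ≡ m' + ∣ S ∣)
    ×
    (Σ ℕ λ n → Σ (Adj n) λ A → Σ (Fin n) λ u → Σ (Fin n) λ v →
      Σ ℕ λ m → Σ ℕ λ m' →
      Setting A u v × IsGpt A m × IsGpt (deleteEdge A u v) m' ×
      m' ≡ m + 2)
proposition4p1 =
  -- the values 3, 2 and 0, 2 are ∣ simplicials _ ∣, which Agda evaluates
  (λ n A u v ((A-sym , _) , _) S Se m m′ → gpt-deleteEdge-bounds A-sym Se) ,
  (3 , K₃ , # 0 , # 1 , commonSimplicialNeighbours K₃ (# 0) (# 1) , 3 , 2 ,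
   mkSetting K₃-simple refl K₃∖e-connected , isSe-commonSimplicialNeighbours K₃ (# 0) (# 1) ,
   isGpt-simplicials (proj₁ K₃-simple) , isGpt-simplicials (deleteEdge-sym (proj₁ K₃-simple)) , refl) ,
  (4 , C₄ , # 0 , # 1 , 0 , 2 ,
   mkSetting C₄-simple refl C₄∖e-connected ,
   isGpt-simplicials (proj₁ C₄-simple) , isGpt-simplicials (deleteEdge-sym (proj₁ C₄-simple)) , refl)
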